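{- Let $G$ be a graph, $n$ a positive integer, and $H$ a Cayley graph on the group $\mathbb{Z}_2^n$. Then there exists a homomorphism from $G$ to $H$ if and only if there exists a homomorphism from $\widehat{G}$ to $H$.
   Context: A homomorphism of graphs is a map of vertex sets sending edges to edges. For a group $\Gamma$ (written additively) with $x+x=0$ for all $x$ and a subset $\Omega$, the Cayley graph $\mathrm{Cay}(\Gamma,\Omega)$ has vertex set $\Gamma$ with $u\sim v$ iff $u-v\in\Omega$. For a graph $G$, $\widehat{G}$ denotes the Cayley graph $\mathrm{Cay}(\mathcal{P}(V(G)),E(G))$: its vertices are all subsets of $V(G)$ (a group under symmetric difference), and two subsets are adjacent iff their symmetric difference is $\{u,v\}$ for some edge $uv$ of $G$. -}

module Defs where

open import Data.Nat using (ℕ)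
open import Data.Fin using (Fin)
open import Data.Bool using (Bool; _xor_)
open import Data.Vec using (Vec; zipWith)
open import Data.Fin.Subset using (Subset; ⁅_⁆; _∪_)
open import Data.Product using (Σ; Σ-syntax; ∃; _×_)
open import Relation.Nullary using (¬_)
open import Relation.Binary.PropositionalEquality using (_≡_)

record Graph : Set₁ where
  field
    size  : ℕ
    Adj   : Fin size → Fin size → Set
    sym   : ∀ {u v} → Adj u v → Adj v u
    irrefl : ∀ {u} → ¬ Adj u u
open Graph public

Hom : {A B : Set} → (A → A → Set) → (B → B → Set) → Set
Hom {A} {B} R S = Σ (A → B) λ f → ∀ {x y} → R x y → S (f x) (f y)

-- The elementary abelian 2-group Z_2^n (and P(V)) as bit vectors; group
-- operation is pointwise xor (= symmetric difference).
_⊕_ : ∀ {n} → Vec Bool n → Vec Bool n → Vec Bool n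
_⊕_ = zipWith _xor_

-- Cayley graph Cay(Z_2^n, Ω): u ~ v iff u - v = u ⊕ v ∈ Ω.
CayAdj : (n : ℕ) → (Ω : Vec Bool n → Set) → Vec Bool n → Vec Bool n → Set
CayAdj n Ω u v = Ω (u ⊕ v)

-- Ĝ = Cay(P(V(G)), E(G)): A ~ B iff A Δ B = {u,v} for some edge uv of G.
HatAdj : (G : Graph) → Subset (size G) → Subset (size G) → Set
HatAdj G A B = Σ[ u ∈ Fin (size G) ] Σ[ v ∈ Fin (size G) ]
  (Adj G u v × (A ⊕ B) ≡ (⁅ u ⁆ ∪ ⁅ v ⁆))

module Submission where

-- Idea.  Ĝ is itself a Cayley graph on the elementary abelian 2-group P(V(G)),
-- with connection set E = { {u,v} | uv ∈ E(G) }, and the subsets of V(G) are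
-- generated by the singletons.
--
--   (⇐)  u ↦ {u} is a homomorphism G → Ĝ (for an edge uv, u ≠ v, so
--        {u} Δ {v} = {u,v}); compose it with the given Ĝ → H.
--   (⇒)  Extend a homomorphism f : G → H = Cay(Z₂ⁿ, Ω) linearly to
--        F(A) = Σ_{u ∈ A} f(u).  A linear map sends Cay(Z₂ᵐ, S) into
--        Cay(Z₂ⁿ, Ω) as soon as it sends S into Ω, and F sends {u,v} to
--        f(u) + f(v) ∈ Ω for every edge uv.

open import Defs hiding (sym)
open import Data.Nat using (ℕ; _≥_)
open import Data.Bool using (Bool; true; false; _xor_)
open import Data.Bool.Properties using (xor-assoc; xor-comm; xor-identityˡ; xor-identityʳ; xor-same)
open import Data.Vec using (Vec; []; _∷_; replicate)
open import Data.Vec.Properties using (zipWith-assoc; zipWith-comm; zipWith-identityˡ; zipWith-identityʳ)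
open import Data.Fin using (Fin; zero; suc)
open import Data.Fin.Subset using (Subset; ⁅_⁆; _∪_) renaming (⊥ to ∅)
open import Data.Fin.Subset.Properties using (∪-identityˡ; ∪-identityʳ)
open import Data.Product using (_,_; Σ-syntax; _×_)
open import Relation.Nullary using (¬_; contradiction)
open import Relation.Binary.PropositionalEquality
open import Relation.Binary.PropositionalEquality.Algebra using (isMagma)
open import Algebra.Bundles using (CommutativeSemigroup)
open import Function.Bundles using (_⇔_; mk⇔)

0v : ∀ {n} → Vec Bool n
0v = replicate _ false

module _ {n : ℕ} where

  ⊕-assoc : (x y z : Vec Bool n) → (x ⊕ y) ⊕ z ≡ x ⊕ (y ⊕ z)
  ⊕-assoc = zipWith-assoc xor-assoc

  ⊕-comm : (x y : Vec Bool n) → x ⊕ y ≡ y ⊕ x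
  ⊕-comm = zipWith-comm xor-comm

  ⊕-identityˡ : (x : Vec Bool n) → 0v ⊕ x ≡ x
  ⊕-identityˡ = zipWith-identityˡ xor-identityˡ

  ⊕-identityʳ : (x : Vec Bool n) → x ⊕ 0v ≡ x
  ⊕-identityʳ = zipWith-identityʳ xor-identityʳ

  -- (Z₂ⁿ, ⊕) as a commutative semigroup, to reuse the library's derived laws.
  ⊕-commutativeSemigroup : CommutativeSemigroup _ _
  ⊕-commutativeSemigroup = record
    { Carrier = Vec Bool n
    ; _≈_     = _≡_
    ; _∙_     = _⊕_
    ; isCommutativeSemigroup = record
      { isSemigroup = record { isMagma = isMagma _⊕_ ; assoc = ⊕-assoc }
      ; comm        = ⊕-comm
      }
    }

  open import Algebra.Properties.CommutativeSemigroup ⊕-commutativeSemigroup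
    using () renaming (interchange to ⊕-interchange) public

⊕-self : ∀ {n} (x : Vec Bool n) → x ⊕ x ≡ 0v
⊕-self []      = refl
⊕-self (b ∷ x) = cong₂ _∷_ (xor-same b) (⊕-self x)

IsLinear : ∀ {m n} → (Vec Bool m → Vec Bool n) → Set
IsLinear φ = ∀ x y → φ (x ⊕ y) ≡ φ x ⊕ φ y

linear-cayleyHom : ∀ {m n} {S : Vec Bool m → Set} {Ω : Vec Bool n → Set}
  (φ : Vec Bool m → Vec Bool n) → IsLinear φ → (∀ s → S s → Ω (φ s)) →
  Hom (CayAdj m S) (CayAdj n Ω)
linear-cayleyHom {Ω = Ω} φ linear S⊆Ω = φ , λ {x} {y} s → subst Ω (linear x y) (S⊆Ω _ s)

pick : ∀ {n} → Bool → Vec Bool n → Vec Bool n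
pick true  x = x
pick false x = 0v

extend : ∀ {m n} → (Fin m → Vec Bool n) → Subset m → Vec Bool n
extend g []      = 0v
extend g (b ∷ A) = pick b (g zero) ⊕ extend (λ i → g (suc i)) A

pick-xor : ∀ {n} a b (x : Vec Bool n) → pick (a xor b) x ≡ pick a x ⊕ pick b x
pick-xor true  true  x = sym (⊕-self x)
pick-xor true  false x = sym (⊕-identityʳ x)
pick-xor false true  x = sym (⊕-identityˡ x)
pick-xor false false x = sym (⊕-identityˡ 0v)

extend-linear : ∀ {m n} (g : Fin m → Vec Bool n) → IsLinear (extend g)
extend-linear g []      []      = sym (⊕-identityˡ 0v)
extend-linear g (a ∷ A) (b ∷ B) = begin
  pick (a xor b) x ⊕ extend g′ (A ⊕ B)
    ≡⟨ cong₂ _⊕_ (pick-xor a b x) (extend-linear g′ A B) ⟩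
  (pick a x ⊕ pick b x) ⊕ (extend g′ A ⊕ extend g′ B)
    ≡⟨ ⊕-interchange (pick a x) (pick b x) (extend g′ A) (extend g′ B) ⟩
  (pick a x ⊕ extend g′ A) ⊕ (pick b x ⊕ extend g′ B) ∎
  where
  open ≡-Reasoning
  x  = g zero
  g′ = λ i → g (suc i)

extend-∅ : ∀ {m n} (g : Fin m → Vec Bool n) → extend g ∅ ≡ 0v
extend-∅ {ℕ.zero}  g = refl
extend-∅ {ℕ.suc m} g = trans (⊕-identityˡ _) (extend-∅ (λ i → g (suc i)))

extend-singleton : ∀ {m n} (g : Fin m → Vec Bool n) u → extend g ⁅ u ⁆ ≡ g u
extend-singleton g zero    =
  trans (cong (g zero ⊕_) (extend-∅ (λ i → g (suc i)))) (⊕-identityʳ _)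
extend-singleton g (suc u) =
  trans (⊕-identityˡ _) (extend-singleton (λ i → g (suc i)) u)

EdgeSet : (G : Graph) → Subset (size G) → Set
EdgeSet G s = Σ[ u ∈ Fin (size G) ] Σ[ v ∈ Fin (size G) ] (Adj G u v × s ≡ ⁅ u ⁆ ∪ ⁅ v ⁆)

hat-isCayley : (G : Graph) → Hom (HatAdj G) (CayAdj (size G) (EdgeSet G))
hat-isCayley G = (λ A → A) , λ e → e

singleton-Δ : ∀ {m} (u v : Fin m) → ¬ u ≡ v → ⁅ u ⁆ ⊕ ⁅ v ⁆ ≡ ⁅ u ⁆ ∪ ⁅ v ⁆
singleton-Δ zero    zero    u≢v = contradiction refl u≢v
singleton-Δ zero    (suc v) u≢v =
  cong (true ∷_) (trans (⊕-identityˡ ⁅ v ⁆) (sym (∪-identityˡ ⁅ v ⁆)))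
singleton-Δ (suc u) zero    u≢v =
  cong (true ∷_) (trans (⊕-identityʳ ⁅ u ⁆) (sym (∪-identityʳ ⁅ u ⁆)))
singleton-Δ (suc u) (suc v) u≢v =
  cong (false ∷_) (singleton-Δ u v (λ u≡v → u≢v (cong suc u≡v)))

adj⇒distinct : (G : Graph) {u v : Fin (size G)} → Adj G u v → ¬ u ≡ v
adj⇒distinct G uv refl = irrefl G uv

singleton-hom : (G : Graph) → Hom (Adj G) (HatAdj G)
singleton-hom G = ⁅_⁆ , λ {u} {v} uv → u , v , uv , singleton-Δ u v (adj⇒distinct G uv)

hom-∘ : {A B C : Set} {R : A → A → Set} {S : B → B → Set} {T : C → C → Set} →
  Hom S T → Hom R S → Hom R T
hom-∘ (g , g-hom) (f , f-hom) = (λ x → g (f x)) , λ r → g-hom (f-hom r)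

extend-hom : (G : Graph) (n : ℕ) (Ω : Vec Bool n → Set) →
  Hom (Adj G) (CayAdj n Ω) → Hom (HatAdj G) (CayAdj n Ω)
extend-hom G n Ω (f , f-hom) =
  hom-∘ {T = CayAdj n Ω}
    (linear-cayleyHom {Ω = Ω} (extend f) (extend-linear f) edge↦Ω)
    (hat-isCayley G)
  where
  edge↦Ω : ∀ s → EdgeSet G s → Ω (extend f s)
  edge↦Ω s (u , v , uv , refl) = subst Ω (sym f[u,v]) (f-hom uv)
    where
    open ≡-Reasoning
    f[u,v] : extend f (⁅ u ⁆ ∪ ⁅ v ⁆) ≡ f u ⊕ f v
    f[u,v] = begin
      extend f (⁅ u ⁆ ∪ ⁅ v ⁆)           ≡⟨ cong (extend f) (sym (singleton-Δ u v (adj⇒distinct G uv))) ⟩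
      extend f (⁅ u ⁆ ⊕ ⁅ v ⁆)           ≡⟨ extend-linear f ⁅ u ⁆ ⁅ v ⁆ ⟩
      extend f ⁅ u ⁆ ⊕ extend f ⁅ v ⁆    ≡⟨ cong₂ _⊕_ (extend-singleton f u) (extend-singleton f v) ⟩
      f u ⊕ f v                          ∎

lemma8 : (G : Graph) (n : ℕ) → n ≥ 1 → (Ω : Vec Bool n → Set) →
    Hom (Adj G) (CayAdj n Ω) ⇔ Hom (HatAdj G) (CayAdj n Ω)
lemma8 G n _ Ω = mk⇔ (extend-hom G n Ω) (λ φ → hom-∘ {T = CayAdj n Ω} φ (singleton-hom G))
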